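{- Let $G=(V,E)$ be a connected undirected graph with $n=|V|\ge 3$, let $a,b\in V$ be two distinct non-adjacent vertices, and let $\beta(n)$ be an integer with $1\le\beta(n)\le n$. Number the vertices of $V\setminus\{a,b\}$ as $1,\dots,n-2$. Call an ab-separator a partition $\{A,B,C\}$ of $V$ with $a\in A$, $b\in B$, such that $E$ contains no edge $\{i,j\}$ with $i\in A$, $j\in B$, and $\max\{|A|,|B|\}\le\beta(n)$; its incidence vector is $X=(x_{1a},\dots,x_{(n-2)a},x_{1b},\dots,x_{(n-2)b})\in\{0,1\}^{2(n-2)}$ with $x_{ia}=1\iff i\in A$ and $x_{ib}=1\iff i\in B$. Let $P_{ab}$ be the convex hull of the incidence vectors of all ab-separators. Let $\Gamma_{ab}$ be a chain (path) in $G$ between $a$ and $b$, and let $I(\Gamma_{ab})$ be the set of internal vertices of $\Gamma_{ab}$ (all its vertices other than $a$ and $b$). Then the inequality $$\sum_{i\in I(\Gamma_{ab})}(x_{ia}+x_{ib})\le |I(\Gamma_{ab})|-1$$ is valid for $P_{ab}$, i.e. it holds for every point of $P_{ab}$.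
   Formalization: Points of $P_{ab}$ have rational coordinates and are convex combinations of incidence vectors with rational weights, in place of real ones. -}

module Defs where

open import Data.Nat as ℕ using (ℕ; _⊔_)
open import Data.Fin using (Fin)
open import Data.List using (List; []; _∷_; _++_; length; filter; allFin; foldr; map)
open import Data.List.Relation.Unary.Linked using (Linked)
open import Data.List.Relation.Unary.Unique.Propositional using (Unique)
open import Data.List.Relation.Unary.All using (All)
open import Data.Product using (Σ; ∃; _×_; _,_; proj₁; proj₂)
open import Data.Sum using (_⊎_)
open import Data.Integer using (+_)
open import Data.Rational using (ℚ; 0ℚ; 1ℚ; _+_; _*_; _-_; _≤_; _/_)
open import Relation.Binary.PropositionalEquality using (_≡_; _≢_)
open import Relation.Nullary using (¬_; Dec; yes; no)

record Graph (n : ℕ) : Set₁ where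
  field
    Adj     : Fin n → Fin n → Set
    sym     : ∀ {u v} → Adj u v → Adj v u
    irrefl  : ∀ {u} → ¬ Adj u u
open Graph public

IsWalk : ∀ {n} → Graph n → Fin n → List (Fin n) → Fin n → Set
IsWalk G u ms v = Linked (Adj G) (u ∷ ms ++ v ∷ [])

-- A path (chain): a walk with pairwise distinct vertices.
-- ms is then exactly the list of internal vertices I(Γ).
IsPath : ∀ {n} → Graph n → Fin n → List (Fin n) → Fin n → Set
IsPath G u ms v = IsWalk G u ms v × Unique (u ∷ ms ++ v ∷ [])

Connected : ∀ {n} → Graph n → Set
Connected {n} G = ∀ (u v : Fin n) → u ≡ v ⊎ ∃ λ ms → IsWalk G u ms v

data Part : Set where
  A B C : Part

_≟P_ : (p q : Part) → Dec (p ≡ q)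
A ≟P A = yes _≡_.refl
A ≟P B = no λ ()
A ≟P C = no λ ()
B ≟P A = no λ ()
B ≟P B = yes _≡_.refl
B ≟P C = no λ ()
C ≟P A = no λ ()
C ≟P B = no λ ()
C ≟P C = yes _≡_.refl

partSize : ∀ {n} → (Fin n → Part) → Part → ℕ
partSize {n} f p = length (filter (λ v → f v ≟P p) (allFin n))

record Separator {n} (G : Graph n) (a b : Fin n) (β : ℕ) : Set where
  field
    part    : Fin n → Part
    a∈A     : part a ≡ A
    b∈B     : part b ≡ B
    noEdge  : ∀ i j → part i ≡ A → part j ≡ B → ¬ Adj G i j
    balance : partSize part A ⊔ partSize part B ℕ.≤ β
open Separator public

indicator : Part → Part → ℚ
indicator A A = 1ℚ
indicator B B = 1ℚ
indicator C C = 1ℚ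
indicator _ _ = 0ℚ

-- A point of the ambient space: the coordinates (x_{ia})_i and (x_{ib})_i,
-- indexed by vertices (only coordinates i ∉ {a,b} are meaningful).
Point : ℕ → Set
Point n = (Fin n → ℚ) × (Fin n → ℚ)

incidence : ∀ {n} {G : Graph n} {a b β} → Separator G a b β → Point n
incidence S = (λ i → indicator (part S i) A) , (λ i → indicator (part S i) B)

sumℚ : List ℚ → ℚ
sumℚ = foldr _+_ 0ℚ

InHull : ∀ {n} (G : Graph n) (a b : Fin n) (β : ℕ) → Point n → Set
InHull {n} G a b β (xa , xb) =
  Σ (List (ℚ × Separator G a b β)) λ ws →
      All (λ w → 0ℚ ≤ proj₁ w) ws
    × sumℚ (map proj₁ ws) ≡ 1ℚ
    × (∀ i → i ≢ a → i ≢ b →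
         xa i ≡ sumℚ (map (λ w → proj₁ w * proj₁ (incidence (proj₂ w)) i) ws)
       × xb i ≡ sumℚ (map (λ w → proj₁ w * proj₂ (incidence (proj₂ w)) i) ws))

ℕtoℚ : ℕ → ℚ
ℕtoℚ k = + k / 1

-- Walking along Γ from a ∈ A to b ∈ B, the walk must leave A,
-- and since no edge joins A to B it first lands in C; that internal vertex contributes
-- x_ia + x_ib = 0, while every other one contributes at most 1. So each incidence vector
-- satisfies the inequality, and it is a linear inequality in the coordinates i ∉ {a,b},
-- hence it survives convex combinations.
module Submission where

open import Defs hiding (sym)
open import Data.Nat using (ℕ; suc; _≤_)
open import Data.Fin using (Fin)
open import Data.List using (List; []; _∷_; _++_; map; length)
open import Data.List.Properties using (map-cong; map-cong-local)
open import Data.List.Relation.Unary.All as All using (All; []; _∷_)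
open import Data.List.Relation.Unary.All.Properties using (++⁻ˡ; ++⁻ʳ)
open import Data.List.Relation.Unary.AllPairs using (AllPairs; _∷_)
open import Data.List.Relation.Unary.Any as Any using (Any; here; there)
open import Data.List.Relation.Unary.Linked using (_∷_; [-])
open import Data.List.Relation.Unary.Unique.Propositional using (Unique)
open import Data.Product using (_×_; _,_; proj₁; proj₂)
open import Data.Rational using (ℚ; mkℚ; 0ℚ; 1ℚ; _+_; _*_; _-_; toℚᵘ; nonNegative)
  renaming (_≤_ to _≤ℚ_)
open import Data.Rational.Properties
open import Algebra.Bundles using (CommutativeMonoid)
open import Algebra.Properties.CommutativeSemigroup (CommutativeMonoid.commutativeSemigroup +-0-commutativeMonoid)
  using () renaming (interchange to +-interchange)
open import Data.Rational.Solver using (module +-*-Solver)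
import Data.Rational.Unnormalised.Base as ℚᵘ
import Data.Rational.Unnormalised.Properties as ℚᵘ
import Data.Nat.Coprimality as Coprimality
import Data.Nat.Properties as ℕ
import Data.Integer as ℤ using (+_)
import Data.Integer.Properties as ℤ
open import Data.Empty using (⊥-elim)
open import Function using (_∘_)
open import Relation.Binary.PropositionalEquality
  using (_≡_; _≢_; refl; sym; trans; cong; cong₂; module ≡-Reasoning)
open import Relation.Nullary using (¬_)
open import Relation.Nullary.Decidable using (toWitness)
open import Data.Unit using (tt)

ℕtoℚ-suc : ∀ k → ℕtoℚ (suc k) ≡ 1ℚ + ℕtoℚ k
ℕtoℚ-suc k = toℚᵘ-injective (ℚᵘ.≃-trans unnormalised (ℚᵘ.≃-sym (toℚᵘ-homo-+ 1ℚ (ℕtoℚ k))))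
  where
  ℕtoℚ-mkℚ : ∀ m → ℕtoℚ m ≡ mkℚ (ℤ.+ m) 0 (Coprimality.sym (Coprimality.1-coprimeTo m))
  ℕtoℚ-mkℚ m = normalize-coprime (Coprimality.sym (Coprimality.1-coprimeTo m))

  unnormalised : toℚᵘ (ℕtoℚ (suc k)) ℚᵘ.≃ toℚᵘ 1ℚ ℚᵘ.+ toℚᵘ (ℕtoℚ k)
  unnormalised rewrite ℕtoℚ-mkℚ k | ℕtoℚ-mkℚ (suc k) | ℕ.*-identityʳ k | ℤ.+◃n≡+n k =
    ℚᵘ.*≡* refl

1+p-1≡p : ∀ p → (1ℚ + p) - 1ℚ ≡ p
1+p-1≡p = solve 1 (λ p → (con 1ℚ :+ p) :- con 1ℚ := p) refl
  where open +-*-Solver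

private variable
  X Y : Set

sumℚ-map-0 : ∀ (xs : List X) → sumℚ (map (λ _ → 0ℚ) xs) ≡ 0ℚ
sumℚ-map-0 []       = refl
sumℚ-map-0 (x ∷ xs) = trans (cong (0ℚ +_) (sumℚ-map-0 xs)) (+-identityˡ 0ℚ)

sumℚ-map-+ : ∀ (f g : X → ℚ) xs →
             sumℚ (map (λ x → f x + g x) xs) ≡ sumℚ (map f xs) + sumℚ (map g xs)
sumℚ-map-+ f g []       = refl
sumℚ-map-+ f g (x ∷ xs) =
  trans (cong ((f x + g x) +_) (sumℚ-map-+ f g xs))
        (+-interchange (f x) (g x) (sumℚ (map f xs)) (sumℚ (map g xs)))

sumℚ-map-*ˡ : ∀ c (f : X → ℚ) xs → sumℚ (map (λ x → c * f x) xs) ≡ c * sumℚ (map f xs)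
sumℚ-map-*ˡ c f []       = sym (*-zeroʳ c)
sumℚ-map-*ˡ c f (x ∷ xs) =
  trans (cong (c * f x +_) (sumℚ-map-*ˡ c f xs)) (sym (*-distribˡ-+ c (f x) _))

sumℚ-map-swap : ∀ (h : X → Y → ℚ) xs ys →
                sumℚ (map (λ x → sumℚ (map (h x) ys)) xs)
                ≡ sumℚ (map (λ y → sumℚ (map (λ x → h x y) xs)) ys)
sumℚ-map-swap h []       ys = sym (sumℚ-map-0 ys)
sumℚ-map-swap h (x ∷ xs) ys =
  trans (cong (sumℚ (map (h x) ys) +_) (sumℚ-map-swap h xs ys))
        (sym (sumℚ-map-+ (h x) (λ y → sumℚ (map (λ x → h x y) xs)) ys))

sumℚ-weighted-≤ : ∀ (v : X → ℚ) c → (∀ x → v x ≤ℚ c) →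
                  ∀ (ws : List (ℚ × X)) → All (λ w → 0ℚ ≤ℚ proj₁ w) ws →
                  sumℚ (map (λ w → proj₁ w * v (proj₂ w)) ws) ≤ℚ sumℚ (map proj₁ ws) * c
sumℚ-weighted-≤ v c v≤c []             []         = ≤-reflexive (sym (*-zeroˡ c))
sumℚ-weighted-≤ v c v≤c ((l , x) ∷ ws) (0≤l ∷ ps) = begin
  l * v x + sumℚ (map (λ w → proj₁ w * v (proj₂ w)) ws)
    ≤⟨ +-mono-≤ (*-monoˡ-≤-nonNeg l {{nonNegative 0≤l}} (v≤c x)) (sumℚ-weighted-≤ v c v≤c ws ps) ⟩
  l * c + sumℚ (map proj₁ ws) * c
    ≡⟨ sym (*-distribʳ-+ c l _) ⟩
  (l + sumℚ (map proj₁ ws)) * c ∎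
  where open ≤-Reasoning

sumℚ-≤-length : ∀ (f : X → ℚ) {xs} → All (λ x → f x ≤ℚ 1ℚ) xs →
                sumℚ (map f xs) ≤ℚ ℕtoℚ (length xs)
sumℚ-≤-length f {[]}     []           = ≤-refl
sumℚ-≤-length f {x ∷ xs} (fx≤1 ∷ f≤1) = begin
  f x + sumℚ (map f xs)   ≤⟨ +-mono-≤ fx≤1 (sumℚ-≤-length f f≤1) ⟩
  1ℚ + ℕtoℚ (length xs)   ≡⟨ sym (ℕtoℚ-suc (length xs)) ⟩
  ℕtoℚ (suc (length xs))  ∎
  where open ≤-Reasoning

sumℚ-≤-length-1 : ∀ (f : X → ℚ) {xs} → All (λ x → f x ≤ℚ 1ℚ) xs → Any (λ x → f x ≡ 0ℚ) xs →
                  sumℚ (map f xs) ≤ℚ ℕtoℚ (length xs) - 1ℚ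
sumℚ-≤-length-1 f {x ∷ xs} (_ ∷ f≤1) (here fx≡0) = begin
  f x + sumℚ (map f xs)              ≡⟨ cong (_+ sumℚ (map f xs)) fx≡0 ⟩
  0ℚ + sumℚ (map f xs)               ≡⟨ +-identityˡ _ ⟩
  sumℚ (map f xs)                    ≤⟨ sumℚ-≤-length f f≤1 ⟩
  ℕtoℚ (length xs)                   ≡⟨ sym (1+p-1≡p (ℕtoℚ (length xs))) ⟩
  (1ℚ + ℕtoℚ (length xs)) - 1ℚ       ≡⟨ cong (_- 1ℚ) (sym (ℕtoℚ-suc (length xs))) ⟩
  ℕtoℚ (suc (length xs)) - 1ℚ        ∎
  where open ≤-Reasoning
sumℚ-≤-length-1 f {x ∷ xs} (fx≤1 ∷ f≤1) (there f0) = begin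
  f x + sumℚ (map f xs)              ≤⟨ +-mono-≤ fx≤1 (sumℚ-≤-length-1 f f≤1 f0) ⟩
  1ℚ + (ℕtoℚ (length xs) - 1ℚ)       ≡⟨ sym (+-assoc 1ℚ (ℕtoℚ (length xs)) _) ⟩
  (1ℚ + ℕtoℚ (length xs)) - 1ℚ       ≡⟨ cong (_- 1ℚ) (sym (ℕtoℚ-suc (length xs))) ⟩
  ℕtoℚ (suc (length xs)) - 1ℚ        ∎
  where open ≤-Reasoning

path-interior-avoids-ends : ∀ {n} {a b : Fin n} Γ → Unique (a ∷ Γ ++ b ∷ []) →
                            All (λ i → i ≢ a × i ≢ b) Γ
path-interior-avoids-ends {a = a} {b} Γ (a∉ ∷ unique) =
  All.zipWith (λ (a≢i , i≢b) → a≢i ∘ sym , i≢b) (++⁻ˡ Γ a∉ , interior-≢-last Γ unique)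
  where
  interior-≢-last : ∀ Δ → AllPairs _≢_ (Δ ++ b ∷ []) → All (_≢ b) Δ
  interior-≢-last []      _              = []
  interior-≢-last (i ∷ Δ) (i∉ ∷ unique) = All.head (++⁻ʳ Δ i∉) ∷ interior-≢-last Δ unique

indicatorA∪B : Part → ℚ
indicatorA∪B p = indicator p A + indicator p B

indicatorA∪B-≤-1 : ∀ p → indicatorA∪B p ≤ℚ 1ℚ
indicatorA∪B-≤-1 A = toWitness {a? = indicatorA∪B A ≤? 1ℚ} tt
indicatorA∪B-≤-1 B = toWitness {a? = indicatorA∪B B ≤? 1ℚ} tt
indicatorA∪B-≤-1 C = toWitness {a? = indicatorA∪B C ≤? 1ℚ} tt

indicatorA∪B-C : indicatorA∪B C ≡ 0ℚ
indicatorA∪B-C = refl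

module _ {n} {G : Graph n} {a b : Fin n} {β : ℕ} where

  walk-from-A-to-B-meets-C : (S : Separator G a b β) {x y : Fin n} (ms : List (Fin n)) →
                             part S x ≡ A → part S y ≡ B → IsWalk G x ms y →
                             Any (λ i → part S i ≡ C) ms
  walk-from-A-to-B-meets-C S []       x∈A y∈B (x~y ∷ [-]) = ⊥-elim (noEdge S _ _ x∈A y∈B x~y)
  walk-from-A-to-B-meets-C S (m ∷ ms) x∈A y∈B (x~m ∷ walk) with part S m in m∈
  ... | A = there (walk-from-A-to-B-meets-C S ms m∈ y∈B walk)
  ... | B = ⊥-elim (noEdge S _ _ x∈A m∈ x~m)
  ... | C = here m∈

  pathSum : Separator G a b β → List (Fin n) → ℚ
  pathSum S Γ = sumℚ (map (λ i → indicatorA∪B (part S i)) Γ)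

  separator-pathSum-≤ : ∀ {Γ} → IsWalk G a Γ b → (S : Separator G a b β) →
                        pathSum S Γ ≤ℚ ℕtoℚ (length Γ) - 1ℚ
  separator-pathSum-≤ {Γ} walk S =
    sumℚ-≤-length-1 (indicatorA∪B ∘ part S) (All.universal (indicatorA∪B-≤-1 ∘ part S) Γ)
      (Any.map (λ i∈C → trans (cong indicatorA∪B i∈C) indicatorA∪B-C)
        (walk-from-A-to-B-meets-C S Γ (a∈A S) (b∈B S) walk))

  hull-pathSum : ∀ {xa xb} (Γ : List (Fin n)) → All (λ i → i ≢ a × i ≢ b) Γ →
                 (hull : InHull G a b β (xa , xb)) →
                 sumℚ (map (λ i → xa i + xb i) Γ)
                 ≡ sumℚ (map (λ w → proj₁ w * pathSum (proj₂ w) Γ) (proj₁ hull))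
  hull-pathSum {xa} {xb} Γ avoids (ws , _ , _ , coords) = begin
    sumℚ (map (λ i → xa i + xb i) Γ)
      ≡⟨ cong sumℚ (map-cong-local (All.map coordinate avoids)) ⟩
    sumℚ (map (λ i → sumℚ (map (λ w → weight w i) ws)) Γ)
      ≡⟨ sumℚ-map-swap (λ i w → weight w i) Γ ws ⟩
    sumℚ (map (λ w → sumℚ (map (weight w) Γ)) ws)
      ≡⟨ cong sumℚ (map-cong (λ w → sumℚ-map-*ˡ (proj₁ w) (indicatorA∪B ∘ part (proj₂ w)) Γ) ws) ⟩
    sumℚ (map (λ w → proj₁ w * pathSum (proj₂ w) Γ) ws) ∎
    where
    open ≡-Reasoning
    weight : ℚ × Separator G a b β → Fin n → ℚ
    weight (l , S) i = l * indicatorA∪B (part S i)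

    coordinate : ∀ {i} → i ≢ a × i ≢ b → xa i + xb i ≡ sumℚ (map (λ w → weight w i) ws)
    coordinate {i} (i≢a , i≢b) = begin
      xa i + xb i
        ≡⟨ cong₂ _+_ (proj₁ (coords i i≢a i≢b)) (proj₂ (coords i i≢a i≢b)) ⟩
      sumℚ (map (λ w → proj₁ w * indicator (part (proj₂ w) i) A) ws)
        + sumℚ (map (λ w → proj₁ w * indicator (part (proj₂ w) i) B) ws)
        ≡⟨ sym (sumℚ-map-+ _ _ ws) ⟩
      sumℚ (map (λ w → proj₁ w * indicator (part (proj₂ w) i) A
                       + proj₁ w * indicator (part (proj₂ w) i) B) ws)
        ≡⟨ cong sumℚ (map-cong (λ (l , S) → sym (*-distribˡ-+ l _ _)) ws) ⟩
      sumℚ (map (λ w → weight w i) ws) ∎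

-- Connectivity, n ≥ 3, a ≢ b, non-adjacency of a and b and the bounds on β belong to the
-- paper's setting; validity of the inequality does not use them.
proposition1 : ∀ (n : ℕ) (G : Graph n) → Connected G → 3 ≤ n
    → (a b : Fin n) → a ≢ b → ¬ Adj G a b
    → (β : ℕ) → 1 ≤ β → β ≤ n
    → (Γ : List (Fin n)) → IsPath G a Γ b
    → ∀ xa xb → InHull G a b β (xa , xb)
    → sumℚ (map (λ i → xa i + xb i) Γ) ≤ℚ (ℕtoℚ (length Γ) - 1ℚ)
proposition1 n G _ _ a b _ _ β _ _ Γ (walk , unique) xa xb hull@(ws , nonneg , total , _) = begin
  sumℚ (map (λ i → xa i + xb i) Γ)
    ≡⟨ hull-pathSum Γ (path-interior-avoids-ends Γ unique) hull ⟩
  sumℚ (map (λ w → proj₁ w * pathSum (proj₂ w) Γ) ws)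
    ≤⟨ sumℚ-weighted-≤ (λ S → pathSum S Γ) c (separator-pathSum-≤ walk) ws nonneg ⟩
  sumℚ (map proj₁ ws) * c
    ≡⟨ trans (cong (_* c) total) (*-identityˡ c) ⟩
  c ∎
  where
  open ≤-Reasoning
  c = ℕtoℚ (length Γ) - 1ℚ
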